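{- For every integer $k\ge 1$, $f(k)\ge \frac{k(k-2)}{3}$.
   Context: An edge-colouring of the complete graph $K_n$ with colours from $[k]=\{1,\dots,k\}$ is a connected $k$-colouring if, for every colour $i\in[k]$, the edges of colour $i$ are non-empty and form a connected spanning subgraph of $K_n$. A triangle of $K_n$ is multicoloured if its three edges receive three distinct colours; its colour set is the set of these three colours. $f(k)$ denotes the minimum, over all $n$ and all connected $k$-colourings of $K_n$, of the number of distinct $3$-subsets of $[k]$ that occur as colour sets of multicoloured triangles. -}

module Defs where

open import Data.Nat using (ℕ; _*_; _∸_; _≤_)
open import Data.Fin using (Fin)
open import Data.Fin.Subset using (Subset; ⁅_⁆; _∪_)
open import Data.Product using (Σ; ∃; ∃-syntax; _×_; _,_)
open import Data.List using (List; length)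
open import Data.List.Relation.Unary.All using (All)
open import Data.List.Relation.Unary.Unique.Propositional using (Unique)
open import Relation.Binary.PropositionalEquality using (_≡_; _≢_)

-- An edge-colouring of K_n with colours from Fin k: a symmetric function on
-- ordered pairs of vertices; only values on pairs u ≢ v (the edges) matter.
record Colouring (n k : ℕ) : Set where
  field
    col : Fin n → Fin n → Fin k
    sym : ∀ u v → col u v ≡ col v u
open Colouring public

data Reach {n k : ℕ} (c : Colouring n k) (a : Fin k) : Fin n → Fin n → Set where
  here : ∀ {u} → Reach c a u u
  step : ∀ {u w v} → u ≢ w → col c u w ≡ a → Reach c a w v → Reach c a u v

ColourConnected : {n k : ℕ} → Colouring n k → Fin k → Set
ColourConnected {n} c a =
  (∃[ u ] ∃[ v ] (u ≢ v × col c u v ≡ a)) × (∀ (u v : Fin n) → Reach c a u v)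

IsConnectedColouring : {n k : ℕ} → Colouring n k → Set
IsConnectedColouring {k = k} c = ∀ (a : Fin k) → ColourConnected c a

colourSet : {k : ℕ} → Fin k → Fin k → Fin k → Subset k
colourSet x y z = ⁅ x ⁆ ∪ (⁅ y ⁆ ∪ ⁅ z ⁆)

OccursAsColourSet : {n k : ℕ} → Colouring n k → Subset k → Set
OccursAsColourSet {n} c S =
  ∃[ u ] ∃[ v ] ∃[ w ]
    ((u ≢ v × v ≢ w × u ≢ w)
    × (col c u v ≢ col c v w × col c v w ≢ col c u w × col c u v ≢ col c u w)
    × S ≡ colourSet (col c u v) (col c v w) (col c u w))

-- Gallai: a connected colouring of K_n with at least three colours has a multicoloured triangle.
-- Otherwise, deleting a vertex v keeps every colour class R connected: each vertex reaches an
-- R-neighbour of v in colour R, and, as no triangle is multicoloured, all R-neighbours of v lie in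
-- the R-component of any S-neighbour and T-neighbour of v (S, T the other colours). Deleting vertices
-- down to K₂ leaves a colour with no edge at all.
--
-- Now fix a colour i and a set X of colours containing i and some other colour but not all colours.
-- Merging the colours into the three classes {i}, X ∖ {i} and the rest keeps the colouring connected,
-- so Gallai gives a multicoloured triangle with colours i, a ∈ X and b ∉ X. Starting from X = {i, r}
-- and adding b each time yields k − 2 distinct colour sets through i. Counting the incidences between
-- the k colours and the colour sets, each set having three colours, gives k (k − 2) ≤ 3 f(k).

module Submission where

open import Defs
open import Data.Bool.Properties using () renaming (_≟_ to _≟ᵇ_)
open import Data.Empty using (⊥-elim)
open import Data.Fin using (Fin; zero; suc; _≟_)
open import Data.Fin.Patterns using (0F; 1F; 2F)
open import Data.Fin.Properties using (suc-injective; any?; ¬∀⟶∃¬)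
open import Data.Fin.Subset using (Subset; ⁅_⁆) renaming (_∈_ to _∈ₛ_)
open import Data.Fin.Subset.Properties using (x∈p∪q⁺; x∈p∪q⁻; x∈⁅x⁆; x∈⁅y⁆⇒x≡y) renaming (_∈?_ to _∈ₛ?_)
open import Data.List using (List; []; _∷_; length; map; filter; allFin; cartesianProduct; deduplicate)
open import Data.List.Properties using (length-tabulate)
open import Data.List.Membership.Propositional using (_∈_; _∉_)
open import Data.List.Membership.Propositional.Properties
  using (∈-allFin; ∈-cartesianProduct⁺; ∈-filter⁺; ∈-filter⁻; ∈-map⁺; ∈-map⁻; ∈-deduplicate⁺; ∈-deduplicate⁻)
open import Data.List.Relation.Binary.Subset.Propositional using (_⊆_)
open import Data.List.Relation.Unary.All as All using (All; []; _∷_)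
open import Data.List.Relation.Unary.AllPairs using ([]; _∷_)
open import Data.List.Relation.Unary.Any using (here; there)
open import Data.List.Relation.Unary.Unique.Propositional using (Unique)
open import Data.List.Relation.Unary.Unique.Propositional.Properties using (allFin⁺; filter⁺)
open import Data.List.Relation.Unary.Unique.DecPropositional.Properties using (deduplicate-!)
open import Data.Nat using (ℕ; zero; suc; _+_; _*_; _∸_; _≤_; z≤n; s≤s)
open import Data.Nat.ListAction using (sum)
open import Data.Nat.Properties
  using (≤-trans; ≤-reflexive; n≤1+n; 1+n≰n; *-comm; +-mono-≤; +-commutativeSemigroup; module ≤-Reasoning)
open import Algebra.Properties.CommutativeSemigroup +-commutativeSemigroup using (x∙yz≈y∙xz)
open import Data.Product using (∃; ∃-syntax; _×_; _,_; -,_; proj₁; proj₂)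
open import Data.Sum using (inj₁; inj₂)
open import Data.Vec.Properties using (≡-dec)
open import Effect.Monad using (RawMonad)
open import Function using (_∘_)
open import Level using (0ℓ)
open import Relation.Nullary using (¬_; Dec; yes; no; ¬?)
open import Relation.Nullary.Decidable using (_×-dec_; decidable-stable)
open import Relation.Nullary.Negation using (¬¬-Monad)
open import Relation.Unary using (Decidable)
open import Relation.Binary.PropositionalEquality as ≡
  using (_≡_; _≢_; refl; trans; cong; subst; ≢-sym; module ≡-Reasoning)

open RawMonad (¬¬-Monad {0ℓ})

private
  variable
    n k l : ℕ
    u v w x y z : Fin n
    a : Fin k

module _ {A : Set} where

  ∈-remove : {x : A} {ys : List A} → x ∈ ys →
             ∃[ zs ] (length ys ≡ suc (length zs) × ∀ {y} → y ∈ ys → y ≢ x → y ∈ zs)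
  ∈-remove (here refl) = -, refl , λ { (here refl) y≢x → ⊥-elim (y≢x refl) ; (there y∈zs) _ → y∈zs }
  ∈-remove (there x∈ys) =
    let zs , length≡ , keep = ∈-remove x∈ys
    in -, cong suc length≡ , λ { (here refl) _ → here refl ; (there y∈ys) y≢x → there (keep y∈ys y≢x) }

  unique⊆⇒length≤ : {xs ys : List A} → Unique xs → xs ⊆ ys → length xs ≤ length ys
  unique⊆⇒length≤ [] _ = z≤n
  unique⊆⇒length≤ (x∉xs ∷ unique) xs⊆ys =
    let zs , length≡ , keep = ∈-remove (xs⊆ys (here refl))
    in subst (_ ≤_) (≡.sym length≡)
         (s≤s (unique⊆⇒length≤ unique λ y∈xs →
           keep (xs⊆ys (there y∈xs)) λ { refl → All.lookup x∉xs y∈xs refl }))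

  sum-map-≥ : ∀ {d} (f : A → ℕ) xs → (∀ {x} → x ∈ xs → d ≤ f x) → length xs * d ≤ sum (map f xs)
  sum-map-≥ f [] _ = z≤n
  sum-map-≥ f (x ∷ xs) d≤f = +-mono-≤ (d≤f (here refl)) (sum-map-≥ f xs λ x∈xs → d≤f (there x∈xs))

  sum-map-≤ : ∀ {e} (f : A → ℕ) xs → (∀ {x} → x ∈ xs → f x ≤ e) → sum (map f xs) ≤ length xs * e
  sum-map-≤ f [] _ = z≤n
  sum-map-≤ f (x ∷ xs) f≤e = +-mono-≤ (f≤e (here refl)) (sum-map-≤ f xs λ x∈xs → f≤e (there x∈xs))

length-allFin : length (allFin n) ≡ n
length-allFin = length-tabulate (λ x → x)

module _ {A B : Set} {R : A → B → Set} (R? : ∀ a b → Dec (R a b)) where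

  sum-degrees-swap : ∀ as bs → sum (map (λ a → length (filter (R? a) bs)) as)
                             ≡ sum (map (λ b → length (filter (λ a → R? a b) as)) bs)
  sum-degrees-swap as [] = sum-zeros as
    where
    sum-zeros : ∀ as → sum (map (λ _ → 0) as) ≡ 0
    sum-zeros [] = refl
    sum-zeros (_ ∷ as) = sum-zeros as
  sum-degrees-swap as (b ∷ bs) =
    trans (peel as) (cong (length (filter (λ a → R? a b) as) +_) (sum-degrees-swap as bs))
    where
    shift : ∀ a as → length (filter (R? a) bs) + sum (map (λ a → length (filter (R? a) (b ∷ bs))) as)
                   ≡ length (filter (λ a → R? a b) as) + sum (map (λ a → length (filter (R? a) bs)) (a ∷ as))
    peel : ∀ as → sum (map (λ a → length (filter (R? a) (b ∷ bs))) as)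
                ≡ length (filter (λ a → R? a b) as) + sum (map (λ a → length (filter (R? a) bs)) as)
    peel [] = refl
    peel (a ∷ as) with R? a b
    ... | yes _ = cong suc (shift a as)
    ... | no _  = shift a as
    shift a as = trans (cong (length (filter (R? a) bs) +_) (peel as))
      (x∙yz≈y∙xz (length (filter (R? a) bs)) (length (filter (λ a → R? a b) as))
                 (sum (map (λ a → length (filter (R? a) bs)) as)))

  double-counting : ∀ {d e} as bs →
    (∀ {a} → a ∈ as → d ≤ length (filter (R? a) bs)) →
    (∀ {b} → b ∈ bs → length (filter (λ a → R? a b) as) ≤ e) →
    length as * d ≤ length bs * e
  double-counting {d} {e} as bs d≤degree degree≤e = begin
    length as * d                                          ≤⟨ sum-map-≥ _ as d≤degree ⟩
    sum (map (λ a → length (filter (R? a) bs)) as)         ≡⟨ sum-degrees-swap as bs ⟩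
    sum (map (λ b → length (filter (λ a → R? a b) as)) bs) ≤⟨ sum-map-≤ _ bs degree≤e ⟩
    length bs * e                                          ∎
    where open ≤-Reasoning

module _ {x y z : Fin k} where

  x∈colourSet : x ∈ₛ colourSet x y z
  x∈colourSet = x∈p∪q⁺ (inj₁ (x∈⁅x⁆ x))

  z∈colourSet : z ∈ₛ colourSet x y z
  z∈colourSet = x∈p∪q⁺ (inj₂ (x∈p∪q⁺ (inj₂ (x∈⁅x⁆ z))))

  ∈colourSet⁻ : ∀ {t} → t ∈ₛ colourSet x y z → t ∈ (x ∷ y ∷ z ∷ [])
  ∈colourSet⁻ t∈ with x∈p∪q⁻ ⁅ x ⁆ _ t∈
  ... | inj₁ t∈x = here (x∈⁅y⁆⇒x≡y x t∈x)
  ... | inj₂ t∈yz with x∈p∪q⁻ ⁅ y ⁆ _ t∈yz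
  ...   | inj₁ t∈y = there (here (x∈⁅y⁆⇒x≡y y t∈y))
  ...   | inj₂ t∈z = there (there (here (x∈⁅y⁆⇒x≡y z t∈z)))

  colourSet-size≤3 : length (filter (_∈ₛ? colourSet x y z) (allFin k)) ≤ 3
  colourSet-size≤3 = unique⊆⇒length≤ (filter⁺ _ (allFin⁺ k)) λ t∈ →
    ∈colourSet⁻ (proj₂ (∈-filter⁻ (_∈ₛ? colourSet x y z) {xs = allFin k} t∈))

Multicoloured : Colouring n k → Fin n → Fin n → Fin n → Set
Multicoloured c u v w =
  (u ≢ v × v ≢ w × u ≢ w) × (col c u v ≢ col c v w × col c v w ≢ col c u w × col c u v ≢ col c u w)

MulticolouredTriangle : Colouring n k → Set
MulticolouredTriangle c = ∃[ u ] ∃[ v ] ∃[ w ] Multicoloured c u v w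

occurs : {c : Colouring n k} → Multicoloured c u v w →
         OccursAsColourSet c (colourSet (col c u v) (col c v w) (col c u w))
occurs (distinct , colours) = -, -, -, distinct , colours , refl

RainbowFree : Colouring n k → Set
RainbowFree c = ∀ {u v w} → ¬ Multicoloured c u v w

multicoloured? : (c : Colouring n k) → ∀ u v w → Dec (Multicoloured c u v w)
multicoloured? c u v w =
  (¬? (u ≟ v) ×-dec ¬? (v ≟ w) ×-dec ¬? (u ≟ w)) ×-dec
  (¬? (col c u v ≟ col c v w) ×-dec ¬? (col c v w ≟ col c u w) ×-dec ¬? (col c u v ≟ col c u w))

multicolouredTriangle? : (c : Colouring n k) → Dec (MulticolouredTriangle c)
multicolouredTriangle? c = any? λ u → any? λ v → any? λ w → multicoloured? c u v w

-- Reachability is not decided, so the vertex-deletion step below can only transport this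
-- double-negated form of connectivity.
¬¬Connected : Colouring n k → Set
¬¬Connected c = ∀ a u v → ¬ ¬ Reach c a u v

module _ {c : Colouring n k} where

  edge : u ≢ v → col c u v ≡ a → Reach c a u v
  edge u≢v e = step u≢v e here

  reach-trans : Reach c a u v → Reach c a v w → Reach c a u w
  reach-trans here q = q
  reach-trans (step u≢w e p) q = step u≢w e (reach-trans p q)

  reach-sym : Reach c a u v → Reach c a v u
  reach-sym here = here
  reach-sym (step {u} {w} u≢w e p) = reach-trans (reach-sym p) (edge (u≢w ∘ ≡.sym) (trans (sym c w u) e))

  module _ (rainbow-free : RainbowFree c) where

    third-edge : u ≢ v → v ≢ w → u ≢ w → col c u v ≢ col c u w → col c v w ≢ col c u w →
                 col c v w ≡ col c u v
    third-edge {u} {v} {w} u≢v v≢w u≢w uv≢uw vw≢uw with col c v w ≟ col c u v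
    ... | yes vw≡uv = vw≡uv
    ... | no vw≢uv = ⊥-elim (rainbow-free ((u≢v , v≢w , u≢w) , (vw≢uv ∘ ≡.sym) , vw≢uw , uv≢uw))

    colour-constant : ¬ Reach c a w x → Reach c a x y → col c w x ≡ col c w y
    colour-constant w↛x here = refl
    colour-constant {a = a} {w = w} {x = x} w↛x (step {w = y} x≢y xy≡a x⇝y) =
      trans w-edges-agree (colour-constant w↛y x⇝y)
      where
      yx≡a : col c y x ≡ a
      yx≡a = trans (sym c y x) xy≡a
      w↛y : ¬ Reach c a w y
      w↛y w⇝y = w↛x (reach-trans w⇝y (edge (x≢y ∘ ≡.sym) yx≡a))
      y≢w : y ≢ w
      y≢w refl = w↛y here
      w≢x : w ≢ x
      w≢x refl = w↛x here
      w-edges-agree : col c w x ≡ col c w y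
      w-edges-agree = trans
        (third-edge y≢w w≢x (x≢y ∘ ≡.sym)
          (λ yw≡yx → w↛y (edge (y≢w ∘ ≡.sym) (trans (sym c w y) (trans yw≡yx yx≡a))))
          (λ wx≡yx → w↛x (edge w≢x (trans wx≡yx yx≡a))))
        (sym c y w)

deleteFirst : Colouring (suc n) k → Colouring n k
deleteFirst c = record { col = λ u v → col c (suc u) (suc v) ; sym = λ u v → sym c (suc u) (suc v) }

rainbowFree-deleteFirst : {c : Colouring (suc n) k} → RainbowFree c → RainbowFree (deleteFirst c)
rainbowFree-deleteFirst rainbow-free ((u≢v , v≢w , u≢w) , colours) =
  rainbow-free ((u≢v ∘ suc-injective , v≢w ∘ suc-injective , u≢w ∘ suc-injective) , colours)

module VertexDeletion (c : Colouring (suc n) k) (rainbow-free : RainbowFree c) where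

  H : Colouring n k
  H = deleteFirst c

  H-colour-constant : ¬ Reach H a w x → Reach H a x y → col H w x ≡ col H w y
  H-colour-constant = colour-constant {c = H} (rainbowFree-deleteFirst {c = c} rainbow-free)

  anchor : Reach c a (suc x) 0F → ∃[ y ] (Reach H a x y × col c 0F (suc y) ≡ a)
  anchor {x = x} (step {w = 0F} _ x0≡a _) = x , here , trans (sym c 0F (suc x)) x0≡a
  anchor (step {w = suc w} x≢w xw≡a w⇝0) =
    let y , w⇝y , 0y≡a = anchor w⇝0 in y , step (x≢w ∘ cong suc) xw≡a w⇝y , 0y≡a

  neighbour : Reach c a 0F (suc x) → ∃[ y ] col c 0F (suc y) ≡ a
  neighbour (step {w = 0F} 0≢0 _ _) = ⊥-elim (0≢0 refl)
  neighbour (step {w = suc y} _ 0y≡a _) = y , 0y≡a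

  unreachable-colour : ∀ {R S} → S ≢ R → col c 0F (suc y) ≡ S → col c 0F (suc w) ≡ R →
                       ¬ Reach H R y w → col H y w ≡ S
  unreachable-colour {y} {w} S≢R 0y≡S 0w≡R y↛w =
    trans (third-edge {c = c} rainbow-free (λ ()) (y≢w ∘ suc-injective) (λ ())
            (λ 0y≡0w → S≢R (trans (≡.sym 0y≡S) (trans 0y≡0w 0w≡R)))
            (λ yw≡0w → y↛w (edge y≢w (trans yw≡0w 0w≡R))))
          0y≡S
    where
    y≢w : y ≢ w
    y≢w refl = y↛w here

  module _ {R S T : Fin k} (S≢R : S ≢ R) (T≢R : T ≢ R) (S≢T : S ≢ T) where
    open ≡-Reasoning

    anchor-reachable : col c 0F (suc y) ≡ S → col c 0F (suc z) ≡ T → Reach H R y z →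
                       col c 0F (suc w) ≡ R → ¬ ¬ Reach H R y w
    anchor-reachable {y} {z} {w} 0y≡S 0z≡T y⇝z 0w≡R y↛w = S≢T (begin
      S          ≡⟨ unreachable-colour S≢R 0y≡S 0w≡R y↛w ⟨
      col H y w  ≡⟨ sym H y w ⟩
      col H w y  ≡⟨ H-colour-constant (y↛w ∘ reach-sym) y⇝z ⟩
      col H w z  ≡⟨ sym H w z ⟩
      col H z w  ≡⟨ unreachable-colour T≢R 0z≡T 0w≡R (y↛w ∘ reach-trans y⇝z) ⟩
      T          ∎)

    module _ (connected : ¬¬Connected c) where

      anchored : ∀ x → ¬ ¬ (∃[ y ] (Reach H R x y × col c 0F (suc y) ≡ R))
      anchored x = anchor <$> connected R (suc x) 0F

      neighbours-reachable : col c 0F (suc y) ≡ S → col c 0F (suc z) ≡ T → ¬ ¬ Reach H R y z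
      neighbours-reachable {y} {z} 0y≡S 0z≡T y↛z =
        anchored y λ (a , y⇝a , 0a≡R) → anchored z λ (b , z⇝b , 0b≡R) → S≢T (begin
          S          ≡⟨ unreachable-colour S≢R 0y≡S 0b≡R (λ y⇝b → y↛z (reach-trans y⇝b (reach-sym z⇝b))) ⟨
          col H y b  ≡⟨ H-colour-constant y↛z z⇝b ⟨
          col H y z  ≡⟨ sym H y z ⟩
          col H z y  ≡⟨ H-colour-constant z↛y y⇝a ⟩
          col H z a  ≡⟨ unreachable-colour T≢R 0z≡T 0a≡R (λ z⇝a → z↛y (reach-trans z⇝a (reach-sym y⇝a))) ⟩
          T          ∎)
        where
        z↛y : ¬ Reach H R z y
        z↛y = y↛z ∘ reach-sym

      reachable : ∀ p q → ¬ ¬ Reach H R p q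
      reachable p q = do
        y , 0y≡S ← neighbour <$> connected S 0F (suc p)
        z , 0z≡T ← neighbour <$> connected T 0F (suc p)
        y⇝z ← neighbours-reachable 0y≡S 0z≡T
        a , p⇝a , 0a≡R ← anchored p
        b , q⇝b , 0b≡R ← anchored q
        y⇝a ← anchor-reachable 0y≡S 0z≡T y⇝z 0a≡R
        y⇝b ← anchor-reachable 0y≡S 0z≡T y⇝z 0b≡R
        pure (reach-trans p⇝a (reach-trans (reach-sym y⇝a) (reach-trans y⇝b (reach-sym q⇝b))))

two-other-colours : (R : Fin (3 + k)) → ∃[ S ] ∃[ T ] (S ≢ R × T ≢ R × S ≢ T)
two-other-colours 0F            = 1F , 2F , (λ ()) , (λ ()) , (λ ())
two-other-colours 1F            = 0F , 2F , (λ ()) , (λ ()) , (λ ())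
two-other-colours (suc (suc _)) = 0F , 1F , (λ ()) , (λ ()) , (λ ())

¬¬Connected-deleteFirst : (c : Colouring (suc n) (3 + k)) → RainbowFree c → ¬¬Connected c →
                          ¬¬Connected (deleteFirst c)
¬¬Connected-deleteFirst c rainbow-free connected R =
  let S , T , S≢R , T≢R , S≢T = two-other-colours R
  in VertexDeletion.reachable c rainbow-free S≢R T≢R S≢T connected

¬¬Connected-K₂ : (c : Colouring 2 (3 + k)) → ¬ ¬¬Connected c
¬¬Connected-K₂ c connected =
  let R , _ , R≢01 , _ = two-other-colours (col c 0F 1F)
  in connected R 0F 1F λ { (step {w = 0F} 0≢0 _ _) → 0≢0 refl
                         ; (step {w = 1F} _ 01≡R _) → R≢01 (≡.sym 01≡R) }

rainbowFree⇒disconnected : (c : Colouring (2 + n) (3 + k)) → RainbowFree c → ¬ ¬¬Connected c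
rainbowFree⇒disconnected {zero} c _ = ¬¬Connected-K₂ c
rainbowFree⇒disconnected {suc n} c rainbow-free connected =
  rainbowFree⇒disconnected (deleteFirst c) (rainbowFree-deleteFirst {c = c} rainbow-free)
    (¬¬Connected-deleteFirst c rainbow-free connected)

connected⇒multicolouredTriangle : (c : Colouring n (3 + k)) → IsConnectedColouring c →
                                  MulticolouredTriangle c
connected⇒multicolouredTriangle {zero} c connected with () ← proj₁ (proj₁ (connected 0F))
connected⇒multicolouredTriangle {suc zero} c connected with 0F , 0F , 0≢0 , _ ← proj₁ (connected 0F) =
  ⊥-elim (0≢0 refl)
connected⇒multicolouredTriangle {suc (suc n)} c connected =
  decidable-stable (multicolouredTriangle? c) λ none →
    rainbowFree⇒disconnected c (λ t → none (-, -, -, t)) λ a u v u↛v → u↛v (proj₂ (connected a) u v)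

recolour : Colouring n k → (Fin k → Fin l) → Colouring n l
recolour c f = record { col = λ u v → f (col c u v) ; sym = λ u v → cong f (sym c u v) }

module _ {c : Colouring n k} {f : Fin k → Fin l} where

  reach-recolour : Reach c a u v → Reach (recolour c f) (f a) u v
  reach-recolour here = here
  reach-recolour (step u≢w e p) = step u≢w (cong f e) (reach-recolour p)

  recolour-connected : IsConnectedColouring c → (∀ b → ∃ λ a → f a ≡ b) →
                       IsConnectedColouring (recolour c f)
  recolour-connected connected f-surjective b with a , refl ← f-surjective b =
    let (u , v , u≢v , uv≡a) , reach = connected a
    in (u , v , u≢v , cong f uv≡a) , λ u v → reach-recolour (reach u v)

  multicoloured-recolour : Multicoloured (recolour c f) u v w → Multicoloured c u v w
  multicoloured-recolour (distinct , c₁ , c₂ , c₃) = distinct , c₁ ∘ cong f , c₂ ∘ cong f , c₃ ∘ cong f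

data Arrangement : Fin 3 → Fin 3 → Fin 3 → Set where
  p₀₁₂ : Arrangement 0F 1F 2F
  p₀₂₁ : Arrangement 0F 2F 1F
  p₁₀₂ : Arrangement 1F 0F 2F
  p₁₂₀ : Arrangement 1F 2F 0F
  p₂₀₁ : Arrangement 2F 0F 1F
  p₂₁₀ : Arrangement 2F 1F 0F

arrangement : {x y z : Fin 3} → x ≢ y → y ≢ z → x ≢ z → Arrangement x y z
arrangement {0F} {0F}      x≢y _   _   = ⊥-elim (x≢y refl)
arrangement {1F} {1F}      x≢y _   _   = ⊥-elim (x≢y refl)
arrangement {2F} {2F}      x≢y _   _   = ⊥-elim (x≢y refl)
arrangement {0F} {1F} {0F} _   _   x≢z = ⊥-elim (x≢z refl)
arrangement {0F} {1F} {1F} _   y≢z _   = ⊥-elim (y≢z refl)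
arrangement {0F} {1F} {2F} _   _   _   = p₀₁₂
arrangement {0F} {2F} {0F} _   _   x≢z = ⊥-elim (x≢z refl)
arrangement {0F} {2F} {1F} _   _   _   = p₀₂₁
arrangement {0F} {2F} {2F} _   y≢z _   = ⊥-elim (y≢z refl)
arrangement {1F} {0F} {0F} _   y≢z _   = ⊥-elim (y≢z refl)
arrangement {1F} {0F} {1F} _   _   x≢z = ⊥-elim (x≢z refl)
arrangement {1F} {0F} {2F} _   _   _   = p₁₀₂
arrangement {1F} {2F} {0F} _   _   _   = p₁₂₀
arrangement {1F} {2F} {1F} _   _   x≢z = ⊥-elim (x≢z refl)
arrangement {1F} {2F} {2F} _   y≢z _   = ⊥-elim (y≢z refl)
arrangement {2F} {0F} {0F} _   y≢z _   = ⊥-elim (y≢z refl)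
arrangement {2F} {0F} {1F} _   _   _   = p₂₀₁
arrangement {2F} {0F} {2F} _   _   x≢z = ⊥-elim (x≢z refl)
arrangement {2F} {1F} {0F} _   _   _   = p₂₁₀
arrangement {2F} {1F} {1F} _   y≢z _   = ⊥-elim (y≢z refl)
arrangement {2F} {1F} {2F} _   _   x≢z = ⊥-elim (x≢z refl)

OrderedTriangle : Colouring n 3 → Set
OrderedTriangle c = ∃[ u ] ∃[ v ] ∃[ w ]
  ((u ≢ v × v ≢ w × u ≢ w) × col c u v ≡ 0F × col c v w ≡ 1F × col c u w ≡ 2F)

orient : (c : Colouring n 3) → Multicoloured c u v w → OrderedTriangle c
orient {u = u} {v} {w} c ((u≢v , v≢w , u≢w) , uv≢vw , vw≢uw , uv≢uw) =
  reorder (arrangement uv≢vw vw≢uw uv≢uw) refl refl refl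
  where
  flip : ∀ {s t : Fin _} {x} → col c s t ≡ x → col c t s ≡ x
  flip {s} {t} st≡x = trans (sym c t s) st≡x
  reorder : ∀ {x y z} → Arrangement x y z →
            col c u v ≡ x → col c v w ≡ y → col c u w ≡ z → OrderedTriangle c
  reorder p₀₁₂ uv vw uw = u , v , w , (u≢v , v≢w , u≢w) , uv , vw , uw
  reorder p₀₂₁ uv vw uw = v , u , w , (≢-sym u≢v , u≢w , v≢w) , flip uv , uw , vw
  reorder p₁₀₂ uv vw uw = w , v , u , (≢-sym v≢w , ≢-sym u≢v , ≢-sym u≢w) , flip vw , flip uv , flip uw
  reorder p₁₂₀ uv vw uw = w , u , v , (≢-sym u≢w , u≢v , ≢-sym v≢w) , flip uw , uv , flip vw
  reorder p₂₀₁ uv vw uw = v , w , u , (v≢w , ≢-sym u≢w , ≢-sym u≢v) , vw , flip uw , flip uv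
  reorder p₂₁₀ uv vw uw = u , w , v , (u≢w , ≢-sym v≢w , u≢v) , uw , flip vw , uv

ordered⇒multicoloured : (c : Colouring n 3) → u ≢ v × v ≢ w × u ≢ w →
  col c u v ≡ 0F → col c v w ≡ 1F → col c u w ≡ 2F → Multicoloured c u v w
ordered⇒multicoloured c distinct uv vw uw rewrite uv | vw | uw = distinct , (λ ()) , (λ ()) , (λ ())

module Crossing (c : Colouring n k) (connected : IsConnectedColouring c)
                {X : Fin k → Set} (X? : Decidable X) {i a b : Fin k}
                (Xi : X i) (a≢i : a ≢ i) (Xa : X a) (¬Xb : ¬ X b) where

  classify : Fin k → Fin 3
  classify x with x ≟ i | X? x
  ... | yes _ | _     = 0F
  ... | no _  | yes _ = 1F
  ... | no _  | no _  = 2F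

  classified-0 : classify x ≡ 0F → x ≡ i
  classified-0 {x} _ with x ≟ i | X? x
  ... | yes x≡i | _ = x≡i
  classified-0 () | no _ | yes _
  classified-0 () | no _ | no _

  classified-1 : classify x ≡ 1F → x ≢ i × X x
  classified-1 {x} _ with x ≟ i | X? x
  classified-1 () | yes _ | _
  ... | no x≢i | yes Xx = x≢i , Xx
  classified-1 () | no _ | no _

  classified-2 : classify x ≡ 2F → ¬ X x
  classified-2 {x} _ with x ≟ i | X? x
  classified-2 () | yes _ | _
  classified-2 () | no _ | yes _
  ... | no _ | no ¬Xx = ¬Xx

  classify-surjective : ∀ t → ∃ λ x → classify x ≡ t
  classify-surjective 0F = i , i-class
    where
    i-class : classify i ≡ 0F
    i-class with i ≟ i
    ... | yes _ = refl
    ... | no i≢i = ⊥-elim (i≢i refl)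
  classify-surjective 1F = a , a-class
    where
    a-class : classify a ≡ 1F
    a-class with a ≟ i | X? a
    ... | yes a≡i | _ = ⊥-elim (a≢i a≡i)
    ... | no _ | yes _ = refl
    ... | no _ | no ¬Xa = ⊥-elim (¬Xa Xa)
  classify-surjective 2F = b , b-class
    where
    b-class : classify b ≡ 2F
    b-class with b ≟ i | X? b
    ... | yes refl | _ = ⊥-elim (¬Xb Xi)
    ... | no _ | yes Xb = ⊥-elim (¬Xb Xb)
    ... | no _ | no _ = refl

  crossing-triangle : ∃[ a′ ] ∃[ b′ ] (a′ ≢ i × X a′ × ¬ X b′ × OccursAsColourSet c (colourSet i a′ b′))
  crossing-triangle =
    let merged = recolour c classify
        _ , _ , _ , multicoloured = connected⇒multicolouredTriangle merged
                                      (recolour-connected connected classify-surjective)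
        u , v , w , distinct , uv , vw , uw = orient merged multicoloured
        vw≢i , X-vw = classified-1 vw
    in col c v w , col c u w , vw≢i , X-vw , classified-2 uw ,
       subst (λ x → OccursAsColourSet c (colourSet x (col c v w) (col c u w))) (classified-0 uv)
         (occurs {c = c} (multicoloured-recolour {c = c} {f = classify}
           (ordered⇒multicoloured merged distinct uv vw uw)))

module Fans (c : Colouring n k) (connected : IsConnectedColouring c) {i r : Fin k} (r≢i : r ≢ i) where

  open import Data.List.Membership.DecPropositional (_≟_ {k}) using () renaming (_∈?_ to _∈ᶠ?_)

  -- Each set {i, a, b} is an edge ab of the link graph of i; the sets form a spanning tree
  -- of the palette minus i.
  record Fan (t : ℕ) : Set where
    field
      palette        : List (Fin k)
      i∈palette      : i ∈ palette
      r∈palette      : r ∈ palette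
      palette-length : length palette ≡ 2 + t
      sets           : List (Subset k)
      sets-unique    : Unique sets
      sets-occur     : All (OccursAsColourSet c) sets
      i∈sets         : All (i ∈ₛ_) sets
      sets⊆palette   : All (λ T → ∀ {x} → x ∈ₛ T → x ∈ palette) sets
      sets-length    : length sets ≡ t

  initial : Fan 0
  initial = record
    { palette = i ∷ r ∷ [] ; i∈palette = here refl ; r∈palette = there (here refl) ; palette-length = refl
    ; sets = [] ; sets-unique = [] ; sets-occur = [] ; i∈sets = [] ; sets⊆palette = [] ; sets-length = refl }

  colour-outside : ∀ {t} → 3 + t ≤ k → (F : Fan t) → ∃ (_∉ Fan.palette F)
  colour-outside {t} 3+t≤k F = ¬∀⟶∃¬ k (_∈ palette) (_∈ᶠ? palette) λ palette-full →
    1+n≰n (begin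
      3 + t             ≤⟨ 3+t≤k ⟩
      k                 ≡⟨ length-allFin ⟨
      length (allFin k) ≤⟨ unique⊆⇒length≤ (allFin⁺ k) (λ {x} _ → palette-full x) ⟩
      length palette    ≡⟨ palette-length ⟩
      2 + t             ∎)
    where open Fan F
          open ≤-Reasoning

  extend : ∀ {t} → 3 + t ≤ k → Fan t → Fan (suc t)
  extend {t} 3+t≤k F =
    let open Fan F
        a , b , _ , a∈palette , b∉palette , occurs-iab =
          Crossing.crossing-triangle c connected (_∈ᶠ? palette) i∈palette r≢i r∈palette
            (proj₂ (colour-outside 3+t≤k F))
        new-set⊆palette : ∀ {x} → x ∈ (i ∷ a ∷ b ∷ []) → x ∈ b ∷ palette
        new-set⊆palette = λ { (here refl) → there i∈palette ; (there (here refl)) → there a∈palette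
                         ; (there (there (here refl))) → here refl }
    in record
      { palette        = b ∷ palette
      ; i∈palette      = there i∈palette
      ; r∈palette      = there r∈palette
      ; palette-length = cong suc palette-length
      ; sets           = colourSet i a b ∷ sets
      ; sets-unique    = All.tabulate (λ T∈sets iab≡T →
                           b∉palette (All.lookup sets⊆palette T∈sets (subst (b ∈ₛ_) iab≡T z∈colourSet)))
                         ∷ sets-unique
      ; sets-occur     = occurs-iab ∷ sets-occur
      ; i∈sets         = x∈colourSet ∷ i∈sets
      ; sets⊆palette   = (λ {x} x∈iab → new-set⊆palette (∈colourSet⁻ x∈iab))
                         ∷ All.map (λ T⊆palette {x} x∈T → there (T⊆palette x∈T)) sets⊆palette
      ; sets-length    = cong suc sets-length
      }

  fan : ∀ t → 2 + t ≤ k → Fan t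
  fan zero    _     = initial
  fan (suc t) 3+t≤k = extend 3+t≤k (fan t (≤-trans (n≤1+n _) 3+t≤k))

module ColourSets (c : Colouring n k) where

  Triangle : Set
  Triangle = Fin n × Fin n × Fin n

  triangles : List Triangle
  triangles = cartesianProduct (allFin n) (cartesianProduct (allFin n) (allFin n))

  IsMulticoloured : Triangle → Set
  IsMulticoloured (u , v , w) = Multicoloured c u v w

  isMulticoloured? : Decidable IsMulticoloured
  isMulticoloured? (u , v , w) = multicoloured? c u v w

  triangle-colourSet : Triangle → Subset k
  triangle-colourSet (u , v , w) = colourSet (col c u v) (col c v w) (col c u w)

  _≟ₛ_ : (S T : Subset k) → Dec (S ≡ T)
  _≟ₛ_ = ≡-dec _≟ᵇ_

  colourSets : List (Subset k)
  colourSets = deduplicate _≟ₛ_ (map triangle-colourSet (filter isMulticoloured? triangles))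

  colourSets-unique : Unique colourSets
  colourSets-unique = deduplicate-! _≟ₛ_ _

  colourSets-sound : All (OccursAsColourSet c) colourSets
  colourSets-sound = All.tabulate λ S∈ →
    let (u , v , w) , t∈ , S≡ = ∈-map⁻ triangle-colourSet (∈-deduplicate⁻ _≟ₛ_ _ S∈)
    in subst (OccursAsColourSet c) (≡.sym S≡)
         (occurs {c = c} (proj₂ (∈-filter⁻ isMulticoloured? {xs = triangles} t∈)))

  colourSets-complete : ∀ {S} → OccursAsColourSet c S → S ∈ colourSets
  colourSets-complete (u , v , w , distinct , colours , refl) =
    ∈-deduplicate⁺ _≟ₛ_ (∈-map⁺ triangle-colourSet (∈-filter⁺ isMulticoloured?
      (∈-cartesianProduct⁺ (∈-allFin u) (∈-cartesianProduct⁺ (∈-allFin v) (∈-allFin w))) (distinct , colours)))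

open ColourSets using (colourSets; colourSets-unique; colourSets-sound)

colourSets-bound : (c : Colouring n (3 + k)) → IsConnectedColouring c →
                   (3 + k) * (1 + k) ≤ 3 * length (colourSets c)
colourSets-bound {k = k} c connected = begin
  (3 + k) * (1 + k)                 ≡⟨ cong (_* (1 + k)) (length-allFin {3 + k}) ⟨
  length (allFin (3 + k)) * (1 + k) ≤⟨ double-counting (λ i T → i ∈ₛ? T) (allFin _) (colourSets c) degree size ⟩
  length (colourSets c) * 3         ≡⟨ *-comm (length (colourSets c)) 3 ⟩
  3 * length (colourSets c)         ∎
  where
  open ≤-Reasoning
  open ColourSets c using (colourSets-complete)
  degree : ∀ {i} → i ∈ allFin (3 + k) → 1 + k ≤ length (filter (i ∈ₛ?_) (colourSets c))
  degree {i} _ =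
    let _ , _ , r≢i , _ = two-other-colours i
        open Fans.Fan (Fans.fan c connected r≢i (1 + k) (≤-reflexive refl))
    in subst (_≤ length (filter (i ∈ₛ?_) (colourSets c))) sets-length
         (unique⊆⇒length≤ sets-unique λ T∈sets →
           ∈-filter⁺ (i ∈ₛ?_) (colourSets-complete (All.lookup sets-occur T∈sets)) (All.lookup i∈sets T∈sets))
  size : ∀ {T} → T ∈ colourSets c → length (filter (_∈ₛ? T) (allFin (3 + k))) ≤ 3
  size T∈ with u , v , w , _ , _ , refl ← All.lookup (colourSets-sound c) T∈ =
    colourSet-size≤3 {x = col c u v} {col c v w} {col c u w}

corollary2 : (k : ℕ) → 1 ≤ k → (n : ℕ) → (c : Colouring n k) → IsConnectedColouring c →
    ∃[ L ] (Unique {A = Subset k} L × All (OccursAsColourSet c) L × k * (k ∸ 2) ≤ 3 * length L)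
corollary2 0                   () _ _ _
corollary2 1                   _ _ _ _ = [] , [] , [] , z≤n
corollary2 2                   _ _ _ _ = [] , [] , [] , z≤n
corollary2 (suc (suc (suc k))) _ _ c connected =
  colourSets c , colourSets-unique c , colourSets-sound c , colourSets-bound c connected
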